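{- For every sentence $A\in\mathsf{Sent}_Q$: if $\vdash_{i3}A$ then $|^{+}A$.
   Context: $\mathcal{L}_Q$: first-order language with $\bot,{\sim},\land,\lor,\to,\forall,\exists$, a countable set $\mathsf{Con}$ of constants, variables, predicate symbols; $\mathsf{Sent}_Q$ its sentences; $\neg A:=A\to\bot$, $A\leftrightarrow B:=(A\to B)\land(B\to A)$. $\vdash_{i3}$ is derivability (from no premises) in the Hilbert system $\mathbf{QBDi3}$ with axioms (Ax1) $A\to(B\to A)$; (Ax2) $(A\to(B\to C))\to((A\to B)\to(A\to C))$; (Ax4) $(A\land B)\to A$; (Ax5) $(A\land B)\to B$; (Ax6) $(C\to A)\to((C\to B)\to(C\to(A\land B)))$; (Ax7) $A\to(A\lor B)$; (Ax8) $B\to(A\lor B)$; (Ax9) $(A\to C)\to((B\to C)\to((A\lor B)\to C))$; (Ax10) $\bot\to A$; (Ax11) $A(t)\to\exists xA$; (Ax12) $\forall x(A(x)\to B)\to(\exists xA(x)\to B)$ ($x$ not free in $B$); (Ax13) $\forall x(B\to A)\to(B\to\forall xA)$ ($x$ not free in $B$); (Ax14) $\forall xA\to A(t)$; (Ax15) $A\to{\sim}\bot$; (Ax16) ${\sim}{\sim}A\leftrightarrow A$; (Ax17) ${\sim}(A\land B)\leftrightarrow({\sim}A\lor{\sim}B)$; (Ax18) ${\sim}(A\lor B)\leftrightarrow({\sim}A\land{\sim}B)$; (Ax19) ${\sim}(A\to B)\leftrightarrow(\neg{\sim}A\land{\sim}B)$; (Ax20) ${\sim}\forall xA\leftrightarrow\exists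 x{\sim}A$; (Ax21) ${\sim}\exists xA\leftrightarrow\forall x{\sim}A$; (i1) $\forall x\neg\neg A\to\neg\neg\forall xA$; (i2) ${\sim}A\to\neg A$; (i3) $\neg\neg(A\lor{\sim}A)$; rules MP and Gen (from $A$ infer $\forall xA$). Slashes $|^{+}A$, $|^{ - }A$ for sentences, defined simultaneously by recursion: $|^{+}P(\vec t)$ iff $\vdash_{i3}P(\vec t)$; $|^{ - }P(\vec t)$ iff $\vdash_{i3}{\sim}P(\vec t)$; not $|^{+}\bot$; $|^{ - }\bot$; $|^{+}{\sim}A$ iff $|^{ - }A$; $|^{ - }{\sim}A$ iff $|^{+}A$; $|^{+}A\land B$ iff $|^{+}A$ and $|^{+}B$; $|^{ - }A\land B$ iff $|^{ - }A$ or $|^{ - }B$; $|^{+}A\lor B$ iff $|^{+}A$ or $|^{+}B$; $|^{ - }A\lor B$ iff $|^{ - }A$ and $|^{ - }B$; $|^{+}A\to B$ iff $\vdash_{i3}A\to B$ and ($|^{+}A$ implies $|^{+}B$); $|^{ - }A\to B$ iff $\vdash_{i3}\neg{\sim}A$ and $|^{ - }B$; $|^{+}\forall xA$ iff $\vdash_{i3}\forall xA$ and $|^{+}A(c)$ for all $c\in\mathsf{Con}$; $|^{ - }\forall xA$ iff $|^{ - }A(c)$ for some $c\in\mathsf{Con}$; $|^{+}\exists xA$ iff $|^{+}A(c)$ for some $c\in\mathsf{Con}$; $|^{ - }\exists xA$ iff $\vdash_{i3}{\sim}\exists xA$ and $|^{ - }A(c)$ for all $c\in\mathsf{Con}$.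 -}

module Defs where

open import Data.Nat using (ℕ; zero; suc; _+_; _<_)
open import Data.List using (List; map)
open import Data.List.Relation.Unary.All using (All)
open import Data.Product using (Σ; _×_)
open import Data.Sum using (_⊎_)
open import Data.Empty using (⊥)
open import Data.Unit using (⊤)

-- Variables are de Bruijn indices (unscoped): var 0 is the innermost
-- bound / first free variable.

Con : Set
Con = ℕ

data Term : Set where
  var : ℕ → Term
  con : Con → Term

infixr 4 _⇒_
infixr 6 _∨_
infixr 7 _∧_
infix 8 ∼_

data Fm : Set where
  pred : ℕ → List Term → Fm
  ⊥ᶠ   : Fm
  ∼_   : Fm → Fm
  _∧_  : Fm → Fm → Fm
  _∨_  : Fm → Fm → Fm
  _⇒_  : Fm → Fm → Fm
  all  : Fm → Fm
  ex   : Fm → Fm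

¬ᶠ_ : Fm → Fm
¬ᶠ A = A ⇒ ⊥ᶠ

_⇔_ : Fm → Fm → Fm
A ⇔ B = (A ⇒ B) ∧ (B ⇒ A)

ext : (ℕ → ℕ) → ℕ → ℕ
ext ρ zero    = zero
ext ρ (suc k) = suc (ρ k)

renT : (ℕ → ℕ) → Term → Term
renT ρ (var k) = var (ρ k)
renT ρ (con c) = con c

ren : (ℕ → ℕ) → Fm → Fm
ren ρ (pred p ts) = pred p (map (renT ρ) ts)
ren ρ ⊥ᶠ          = ⊥ᶠ
ren ρ (∼ A)       = ∼ ren ρ A
ren ρ (A ∧ B)     = ren ρ A ∧ ren ρ B
ren ρ (A ∨ B)     = ren ρ A ∨ ren ρ B
ren ρ (A ⇒ B)     = ren ρ A ⇒ ren ρ B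
ren ρ (all A)     = all (ren (ext ρ) A)
ren ρ (ex A)      = ex (ren (ext ρ) A)

weaken : Fm → Fm
weaken = ren suc

exts : (ℕ → Term) → ℕ → Term
exts σ zero    = var zero
exts σ (suc k) = renT suc (σ k)

subT : (ℕ → Term) → Term → Term
subT σ (var k) = σ k
subT σ (con c) = con c

sub : (ℕ → Term) → Fm → Fm
sub σ (pred p ts) = pred p (map (subT σ) ts)
sub σ ⊥ᶠ          = ⊥ᶠ
sub σ (∼ A)       = ∼ sub σ A
sub σ (A ∧ B)     = sub σ A ∧ sub σ B
sub σ (A ∨ B)     = sub σ A ∨ sub σ B
sub σ (A ⇒ B)     = sub σ A ⇒ sub σ B
sub σ (all A)     = all (sub (exts σ) A)
sub σ (ex A)      = ex (sub (exts σ) A)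

single : Term → ℕ → Term
single t zero    = t
single t (suc k) = var k

-- A [ t ] : A(t), substitute t for the variable bound by the outer quantifier
_[_] : Fm → Term → Fm
A [ t ] = sub (single t) A

TermBelow : ℕ → Term → Set
TermBelow n (var k) = k < n
TermBelow n (con c) = ⊤

Below : ℕ → Fm → Set
Below n (pred p ts) = All (TermBelow n) ts
Below n ⊥ᶠ          = ⊤
Below n (∼ A)       = Below n A
Below n (A ∧ B)     = Below n A × Below n B
Below n (A ∨ B)     = Below n A × Below n B
Below n (A ⇒ B)     = Below n A × Below n B
Below n (all A)     = Below (suc n) A
Below n (ex A)      = Below (suc n) A

Sentence : Fm → Set
Sentence = Below 0

infix 2 ⊢_

data ⊢_ : Fm → Set where
  ax1  : ∀ A B → ⊢ A ⇒ (B ⇒ A)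
  ax2  : ∀ A B C → ⊢ (A ⇒ (B ⇒ C)) ⇒ ((A ⇒ B) ⇒ (A ⇒ C))
  ax4  : ∀ A B → ⊢ (A ∧ B) ⇒ A
  ax5  : ∀ A B → ⊢ (A ∧ B) ⇒ B
  ax6  : ∀ A B C → ⊢ (C ⇒ A) ⇒ ((C ⇒ B) ⇒ (C ⇒ (A ∧ B)))
  ax7  : ∀ A B → ⊢ A ⇒ (A ∨ B)
  ax8  : ∀ A B → ⊢ B ⇒ (A ∨ B)
  ax9  : ∀ A B C → ⊢ (A ⇒ C) ⇒ ((B ⇒ C) ⇒ ((A ∨ B) ⇒ C))
  ax10 : ∀ A → ⊢ ⊥ᶠ ⇒ A
  ax11 : ∀ A t → ⊢ (A [ t ]) ⇒ ex A
  -- x not free in B  is expressed by weakening B under the binder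
  ax12 : ∀ A B → ⊢ all (A ⇒ weaken B) ⇒ (ex A ⇒ B)
  ax13 : ∀ A B → ⊢ all (weaken B ⇒ A) ⇒ (B ⇒ all A)
  ax14 : ∀ A t → ⊢ all A ⇒ (A [ t ])
  ax15 : ∀ A → ⊢ A ⇒ ∼ ⊥ᶠ
  ax16 : ∀ A → ⊢ (∼ ∼ A) ⇔ A
  ax17 : ∀ A B → ⊢ (∼ (A ∧ B)) ⇔ (∼ A ∨ ∼ B)
  ax18 : ∀ A B → ⊢ (∼ (A ∨ B)) ⇔ (∼ A ∧ ∼ B)
  ax19 : ∀ A B → ⊢ (∼ (A ⇒ B)) ⇔ ((¬ᶠ (∼ A)) ∧ ∼ B)
  ax20 : ∀ A → ⊢ (∼ all A) ⇔ ex (∼ A)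
  ax21 : ∀ A → ⊢ (∼ ex A) ⇔ all (∼ A)
  i1   : ∀ A → ⊢ all (¬ᶠ ¬ᶠ A) ⇒ (¬ᶠ ¬ᶠ all A)
  i2   : ∀ A → ⊢ (∼ A) ⇒ (¬ᶠ A)
  i3   : ∀ A → ⊢ ¬ᶠ ¬ᶠ (A ∨ ∼ A)
  mp   : ∀ {A B} → ⊢ A ⇒ B → ⊢ A → ⊢ B
  gen  : ∀ {A} → ⊢ A → ⊢ all A

-- The recursion in the quantifier clauses goes
-- through A(c), which is not a structural subterm; we recurse on a fuel
-- argument and instantiate it with the size of the formula (substitution
-- of a constant preserves size, so the fuel never runs out).

size : Fm → ℕ
size (pred p ts) = 1
size ⊥ᶠ          = 1
size (∼ A)       = suc (size A)
size (A ∧ B)     = suc (size A + size B)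
size (A ∨ B)     = suc (size A + size B)
size (A ⇒ B)     = suc (size A + size B)
size (all A)     = suc (size A)
size (ex A)      = suc (size A)

mutual
  S⁺ : ℕ → Fm → Set
  S⁺ zero    A           = ⊥
  S⁺ (suc k) (pred p ts) = ⊢ pred p ts
  S⁺ (suc k) ⊥ᶠ          = ⊥
  S⁺ (suc k) (∼ A)       = S⁻ k A
  S⁺ (suc k) (A ∧ B)     = S⁺ k A × S⁺ k B
  S⁺ (suc k) (A ∨ B)     = S⁺ k A ⊎ S⁺ k B
  S⁺ (suc k) (A ⇒ B)     = (⊢ A ⇒ B) × (S⁺ k A → S⁺ k B)
  S⁺ (suc k) (all A)     = (⊢ all A) × ((c : Con) → S⁺ k (A [ con c ]))
  S⁺ (suc k) (ex A)      = Σ Con (λ c → S⁺ k (A [ con c ]))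

  S⁻ : ℕ → Fm → Set
  S⁻ zero    A           = ⊥
  S⁻ (suc k) (pred p ts) = ⊢ ∼ pred p ts
  S⁻ (suc k) ⊥ᶠ          = ⊤
  S⁻ (suc k) (∼ A)       = S⁺ k A
  S⁻ (suc k) (A ∧ B)     = S⁻ k A ⊎ S⁻ k B
  S⁻ (suc k) (A ∨ B)     = S⁻ k A × S⁻ k B
  S⁻ (suc k) (A ⇒ B)     = (⊢ ¬ᶠ (∼ A)) × S⁻ k B
  S⁻ (suc k) (all A)     = Σ Con (λ c → S⁻ k (A [ con c ]))
  S⁻ (suc k) (ex A)      = (⊢ ∼ ex A) × ((c : Con) → S⁻ k (A [ con c ]))

|⁺_ : Fm → Set
|⁺ A = S⁺ (size A) A

|⁻_ : Fm → Set
|⁻ A = S⁻ (size A) A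

{-# OPTIONS --safe #-}
-- Induction on derivations, strengthened to closed instances: if ⊢ A then |⁺ A′ for every
-- A′ obtained by substituting constants for the free variables of A, since Gen passes through
-- open formulas.  The slashes of A ⇒ B and ∀xA ask for derivability, so one first shows that
-- |⁺ A gives ⊢ A and |⁻ A gives ⊢ ∼A.  The double negations in i1–i3 are then harmless:
-- |⁺ ¬A is equivalent to ⊢ ¬A because QBDi3 is consistent, being sound for the two-valued
-- reading with false atoms, classical ∼ and vacuous quantifiers.
module Submission where

open import Defs renaming (_⇔_ to _⇔ᶠ_)
open import Data.Bool using (Bool; true; false; not) renaming (_∧_ to _∧ᵇ_; _∨_ to _∨ᵇ_)
open import Data.Bool.Properties using (∨-inverseˡ)
open import Data.Nat using (ℕ; zero; suc; _+_; _<_; _≤_; s≤s)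
open import Data.Nat.Properties using (m+n≤o⇒m≤o; m+n≤o⇒n≤o; ≤-refl; m≤m+n; m≤n+m)
open import Data.List.Properties using (map-cong; map-∘; map-id; map-id-local)
import Data.List.Relation.Unary.All as All
open import Data.Product using (Σ; _×_; _,_; proj₁; proj₂)
open import Data.Product.Function.NonDependent.Propositional using (_×-⇔_)
open import Data.Sum using (_⊎_; inj₁; inj₂; [_,_])
open import Data.Sum.Function.Propositional using (_⊎-⇔_)
open import Data.Unit using (tt)
open import Function using (_∘_; id)
open import Function.Bundles using (_⇔_; mk⇔; Equivalence)
import Function.Properties.Equivalence as ⇔
open import Function.Construct.Identity using (↠-id)
open import Data.Product.Function.Dependent.Propositional using (Σ-⇔)
open import Function.Related.TypeIsomorphisms using (→-cong-⇔)
open import Relation.Nullary using (¬_)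
open import Relation.Binary.PropositionalEquality
  using (_≡_; _≗_; refl; sym; trans; cong; cong₂; subst; module ≡-Reasoning)

open Equivalence using (to; from)

exts-cong : ∀ {σ τ} → σ ≗ τ → exts σ ≗ exts τ
exts-cong σ≗τ zero    = refl
exts-cong σ≗τ (suc k) = cong (renT suc) (σ≗τ k)

subT-cong : ∀ {σ τ} → σ ≗ τ → subT σ ≗ subT τ
subT-cong σ≗τ (var k) = σ≗τ k
subT-cong σ≗τ (con c) = refl

sub-cong : ∀ {σ τ} → σ ≗ τ → sub σ ≗ sub τ
sub-cong σ≗τ (pred p ts) = cong (pred p) (map-cong (subT-cong σ≗τ) ts)
sub-cong σ≗τ ⊥ᶠ          = refl
sub-cong σ≗τ (∼ A)       = cong ∼_ (sub-cong σ≗τ A)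
sub-cong σ≗τ (A ∧ B)     = cong₂ _∧_ (sub-cong σ≗τ A) (sub-cong σ≗τ B)
sub-cong σ≗τ (A ∨ B)     = cong₂ _∨_ (sub-cong σ≗τ A) (sub-cong σ≗τ B)
sub-cong σ≗τ (A ⇒ B)     = cong₂ _⇒_ (sub-cong σ≗τ A) (sub-cong σ≗τ B)
sub-cong σ≗τ (all A)     = cong all (sub-cong (exts-cong σ≗τ) A)
sub-cong σ≗τ (ex A)      = cong ex (sub-cong (exts-cong σ≗τ) A)

subT-∘ : ∀ σ τ → subT σ ∘ subT τ ≗ subT (subT σ ∘ τ)
subT-∘ σ τ (var k) = refl
subT-∘ σ τ (con c) = refl

subT-exts-renT : ∀ σ t → subT (exts σ) (renT suc t) ≡ renT suc (subT σ t)
subT-exts-renT σ (var k) = refl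
subT-exts-renT σ (con c) = refl

exts-∘ : ∀ σ τ → subT (exts σ) ∘ exts τ ≗ exts (subT σ ∘ τ)
exts-∘ σ τ zero    = refl
exts-∘ σ τ (suc k) = subT-exts-renT σ (τ k)

sub-∘ : ∀ σ τ → sub σ ∘ sub τ ≗ sub (subT σ ∘ τ)
sub-∘ σ τ (pred p ts) = cong (pred p) (trans (sym (map-∘ ts)) (map-cong (subT-∘ σ τ) ts))
sub-∘ σ τ ⊥ᶠ          = refl
sub-∘ σ τ (∼ A)       = cong ∼_ (sub-∘ σ τ A)
sub-∘ σ τ (A ∧ B)     = cong₂ _∧_ (sub-∘ σ τ A) (sub-∘ σ τ B)
sub-∘ σ τ (A ∨ B)     = cong₂ _∨_ (sub-∘ σ τ A) (sub-∘ σ τ B)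
sub-∘ σ τ (A ⇒ B)     = cong₂ _⇒_ (sub-∘ σ τ A) (sub-∘ σ τ B)
sub-∘ σ τ (all A)     = cong all (trans (sub-∘ (exts σ) (exts τ) A) (sub-cong (exts-∘ σ τ) A))
sub-∘ σ τ (ex A)      = cong ex (trans (sub-∘ (exts σ) (exts τ) A) (sub-cong (exts-∘ σ τ) A))

renT-as-subT : ∀ ρ → renT ρ ≗ subT (var ∘ ρ)
renT-as-subT ρ (var k) = refl
renT-as-subT ρ (con c) = refl

var-ext : ∀ ρ → var ∘ ext ρ ≗ exts (var ∘ ρ)
var-ext ρ zero    = refl
var-ext ρ (suc k) = refl

ren-as-sub : ∀ ρ → ren ρ ≗ sub (var ∘ ρ)
ren-as-sub ρ (pred p ts) = cong (pred p) (map-cong (renT-as-subT ρ) ts)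
ren-as-sub ρ ⊥ᶠ          = refl
ren-as-sub ρ (∼ A)       = cong ∼_ (ren-as-sub ρ A)
ren-as-sub ρ (A ∧ B)     = cong₂ _∧_ (ren-as-sub ρ A) (ren-as-sub ρ B)
ren-as-sub ρ (A ∨ B)     = cong₂ _∨_ (ren-as-sub ρ A) (ren-as-sub ρ B)
ren-as-sub ρ (A ⇒ B)     = cong₂ _⇒_ (ren-as-sub ρ A) (ren-as-sub ρ B)
ren-as-sub ρ (all A)     = cong all (trans (ren-as-sub (ext ρ) A) (sub-cong (var-ext ρ) A))
ren-as-sub ρ (ex A)      = cong ex (trans (ren-as-sub (ext ρ) A) (sub-cong (var-ext ρ) A))

subT-id : subT var ≗ id
subT-id (var k) = refl
subT-id (con c) = refl

exts-id : exts var ≗ var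
exts-id zero    = refl
exts-id (suc k) = refl

sub-id : sub var ≗ id
sub-id (pred p ts) = cong (pred p) (trans (map-cong subT-id ts) (map-id ts))
sub-id ⊥ᶠ          = refl
sub-id (∼ A)       = cong ∼_ (sub-id A)
sub-id (A ∧ B)     = cong₂ _∧_ (sub-id A) (sub-id B)
sub-id (A ∨ B)     = cong₂ _∨_ (sub-id A) (sub-id B)
sub-id (A ⇒ B)     = cong₂ _⇒_ (sub-id A) (sub-id B)
sub-id (all A)     = cong all (trans (sub-cong exts-id A) (sub-id A))
sub-id (ex A)      = cong ex (trans (sub-cong exts-id A) (sub-id A))

FixesBelow : ℕ → (ℕ → Term) → Set
FixesBelow n σ = ∀ {k} → k < n → σ k ≡ var k

subT-below : ∀ {n σ} → FixesBelow n σ → ∀ {t} → TermBelow n t → subT σ t ≡ t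
subT-below σ-id {var k} k<n = σ-id k<n
subT-below σ-id {con c} _          = refl

exts-below : ∀ {n σ} → FixesBelow n σ → FixesBelow (suc n) (exts σ)
exts-below σ-id {zero}  _          = refl
exts-below σ-id {suc k} (s≤s k<n) = cong (renT suc) (σ-id k<n)

sub-below : ∀ {n σ} → FixesBelow n σ → ∀ A → Below n A → sub σ A ≡ A
sub-below σ-id (pred p ts) b       = cong (pred p) (map-id-local (All.map (subT-below σ-id) b))
sub-below σ-id ⊥ᶠ          _          = refl
sub-below σ-id (∼ A)       b       = cong ∼_ (sub-below σ-id A b)
sub-below σ-id (A ∧ B)     (a , b) = cong₂ _∧_ (sub-below σ-id A a) (sub-below σ-id B b)
sub-below σ-id (A ∨ B)     (a , b) = cong₂ _∨_ (sub-below σ-id A a) (sub-below σ-id B b)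
sub-below σ-id (A ⇒ B)     (a , b) = cong₂ _⇒_ (sub-below σ-id A a) (sub-below σ-id B b)
sub-below σ-id (all A)     b       = cong all (sub-below (exts-below σ-id) A b)
sub-below σ-id (ex A)      b       = cong ex (sub-below (exts-below σ-id) A b)

sub-sentence : ∀ σ A → Sentence A → sub σ A ≡ A
sub-sentence σ = sub-below (λ ())

infixr 5 _∷ₛ_

_∷ₛ_ : ∀ {X : Set} → X → (ℕ → X) → ℕ → X
(x ∷ₛ σ) zero    = x
(x ∷ₛ σ) (suc k) = σ k

subT-single-renT : ∀ u t → subT (single u) (renT suc t) ≡ t
subT-single-renT u (var k) = refl
subT-single-renT u (con c) = refl

sub-exts-[] : ∀ σ t A → sub (exts σ) A [ t ] ≡ sub (t ∷ₛ σ) A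
sub-exts-[] σ t A = trans (sub-∘ (single t) (exts σ) A) (sub-cong single-exts A)
  where
  single-exts : subT (single t) ∘ exts σ ≗ t ∷ₛ σ
  single-exts zero    = refl
  single-exts (suc k) = subT-single-renT t (σ k)

sub-[] : ∀ σ t A → sub σ (A [ t ]) ≡ sub (exts σ) A [ subT σ t ]
sub-[] σ t A = begin
  sub σ (A [ t ])                 ≡⟨ sub-∘ σ (single t) A ⟩
  sub (subT σ ∘ single t) A       ≡⟨ sub-cong σ-single A ⟩
  sub (subT σ t ∷ₛ σ) A           ≡⟨ sym (sub-exts-[] σ (subT σ t) A) ⟩
  sub (exts σ) A [ subT σ t ]     ∎
  where
  open ≡-Reasoning
  σ-single : subT σ ∘ single t ≗ subT σ t ∷ₛ σ
  σ-single zero    = refl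
  σ-single (suc k) = refl

sub-weaken : ∀ σ B → sub (exts σ) (weaken B) ≡ weaken (sub σ B)
sub-weaken σ B = begin
  sub (exts σ) (weaken B)            ≡⟨ cong (sub (exts σ)) (ren-as-sub suc B) ⟩
  sub (exts σ) (sub (var ∘ suc) B)   ≡⟨ sub-∘ (exts σ) (var ∘ suc) B ⟩
  sub (renT suc ∘ σ) B               ≡⟨ sub-cong (renT-as-subT suc ∘ σ) B ⟩
  sub (subT (var ∘ suc) ∘ σ) B       ≡⟨ sym (sub-∘ (var ∘ suc) σ B) ⟩
  sub (var ∘ suc) (sub σ B)          ≡⟨ sym (ren-as-sub suc (sub σ B)) ⟩
  weaken (sub σ B)                   ∎
  where open ≡-Reasoning

weaken-[] : ∀ t B → weaken B [ t ] ≡ B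
weaken-[] t B = begin
  weaken B [ t ]                     ≡⟨ cong (_[ t ]) (ren-as-sub suc B) ⟩
  sub (single t) (sub (var ∘ suc) B) ≡⟨ sub-∘ (single t) (var ∘ suc) B ⟩
  sub var B                          ≡⟨ sub-id B ⟩
  B                                  ∎
  where open ≡-Reasoning

size-sub : ∀ σ A → size (sub σ A) ≡ size A
size-sub σ (pred p ts) = refl
size-sub σ ⊥ᶠ          = refl
size-sub σ (∼ A)       = cong suc (size-sub σ A)
size-sub σ (A ∧ B)     = cong₂ (λ m n → suc (m + n)) (size-sub σ A) (size-sub σ B)
size-sub σ (A ∨ B)     = cong₂ (λ m n → suc (m + n)) (size-sub σ A) (size-sub σ B)
size-sub σ (A ⇒ B)     = cong₂ (λ m n → suc (m + n)) (size-sub σ A) (size-sub σ B)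
size-sub σ (all A)     = cong suc (size-sub (exts σ) A)
size-sub σ (ex A)      = cong suc (size-sub (exts σ) A)

⊢-sub : ∀ {A} → ⊢ A → ∀ σ → ⊢ sub σ A
⊢-sub (ax1 A B)   σ = ax1 _ _
⊢-sub (ax2 A B C) σ = ax2 _ _ _
⊢-sub (ax4 A B)   σ = ax4 _ _
⊢-sub (ax5 A B)   σ = ax5 _ _
⊢-sub (ax6 A B C) σ = ax6 _ _ _
⊢-sub (ax7 A B)   σ = ax7 _ _
⊢-sub (ax8 A B)   σ = ax8 _ _
⊢-sub (ax9 A B C) σ = ax9 _ _ _
⊢-sub (ax10 A)    σ = ax10 _
⊢-sub (ax11 A t)  σ rewrite sub-[] σ t A = ax11 _ _
⊢-sub (ax12 A B)  σ rewrite sub-weaken σ B = ax12 _ _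
⊢-sub (ax13 A B)  σ rewrite sub-weaken σ B = ax13 _ _
⊢-sub (ax14 A t)  σ rewrite sub-[] σ t A = ax14 _ _
⊢-sub (ax15 A)    σ = ax15 _
⊢-sub (ax16 A)    σ = ax16 _
⊢-sub (ax17 A B)  σ = ax17 _ _
⊢-sub (ax18 A B)  σ = ax18 _ _
⊢-sub (ax19 A B)  σ = ax19 _ _
⊢-sub (ax20 A)    σ = ax20 _
⊢-sub (ax21 A)    σ = ax21 _
⊢-sub (i1 A)      σ = i1 _
⊢-sub (i2 A)      σ = i2 _
⊢-sub (i3 A)      σ = i3 _
⊢-sub (mp d e)    σ = mp (⊢-sub d σ) (⊢-sub e σ)
⊢-sub (gen d)     σ = gen (⊢-sub d (exts σ))

⟦_⟧ : Fm → Bool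
⟦ pred p ts ⟧ = false
⟦ ⊥ᶠ ⟧        = false
⟦ ∼ A ⟧       = not ⟦ A ⟧
⟦ A ∧ B ⟧     = ⟦ A ⟧ ∧ᵇ ⟦ B ⟧
⟦ A ∨ B ⟧     = ⟦ A ⟧ ∨ᵇ ⟦ B ⟧
⟦ A ⇒ B ⟧     = not ⟦ A ⟧ ∨ᵇ ⟦ B ⟧
⟦ all A ⟧     = ⟦ A ⟧
⟦ ex A ⟧      = ⟦ A ⟧

⟦⟧-sub : ∀ σ A → ⟦ sub σ A ⟧ ≡ ⟦ A ⟧
⟦⟧-sub σ (pred p ts) = refl
⟦⟧-sub σ ⊥ᶠ          = refl
⟦⟧-sub σ (∼ A)       = cong not (⟦⟧-sub σ A)
⟦⟧-sub σ (A ∧ B)     = cong₂ _∧ᵇ_ (⟦⟧-sub σ A) (⟦⟧-sub σ B)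
⟦⟧-sub σ (A ∨ B)     = cong₂ _∨ᵇ_ (⟦⟧-sub σ A) (⟦⟧-sub σ B)
⟦⟧-sub σ (A ⇒ B)     = cong₂ (λ a b → not a ∨ᵇ b) (⟦⟧-sub σ A) (⟦⟧-sub σ B)
⟦⟧-sub σ (all A)     = ⟦⟧-sub (exts σ) A
⟦⟧-sub σ (ex A)      = ⟦⟧-sub (exts σ) A

⟦⟧-weaken : ∀ B → ⟦ weaken B ⟧ ≡ ⟦ B ⟧
⟦⟧-weaken B = trans (cong ⟦_⟧ (ren-as-sub suc B)) (⟦⟧-sub (var ∘ suc) B)

⊢⇒⟦⟧≡true : ∀ {A} → ⊢ A → ⟦ A ⟧ ≡ true
⊢⇒⟦⟧≡true (ax1 A B) with ⟦ A ⟧ | ⟦ B ⟧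
... | false | _     = refl
... | true  | false = refl
... | true  | true  = refl
⊢⇒⟦⟧≡true (ax2 A B C) with ⟦ A ⟧ | ⟦ B ⟧ | ⟦ C ⟧
... | false | _     | _     = refl
... | true  | false | _     = refl
... | true  | true  | false = refl
... | true  | true  | true  = refl
⊢⇒⟦⟧≡true (ax4 A B) with ⟦ A ⟧ | ⟦ B ⟧
... | false | _     = refl
... | true  | false = refl
... | true  | true  = refl
⊢⇒⟦⟧≡true (ax5 A B) with ⟦ A ⟧ | ⟦ B ⟧
... | false | _     = refl
... | true  | false = refl
... | true  | true  = refl
⊢⇒⟦⟧≡true (ax6 A B C) with ⟦ A ⟧ | ⟦ B ⟧ | ⟦ C ⟧
... | _     | _     | false = refl
... | false | _     | true  = refl
... | true  | false | true  = refl
... | true  | true  | true  = refl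
⊢⇒⟦⟧≡true (ax7 A B) with ⟦ A ⟧ | ⟦ B ⟧
... | false | _     = refl
... | true  | _     = refl
⊢⇒⟦⟧≡true (ax8 A B) with ⟦ A ⟧ | ⟦ B ⟧
... | _     | false = refl
... | false | true  = refl
... | true  | true  = refl
⊢⇒⟦⟧≡true (ax9 A B C) with ⟦ A ⟧ | ⟦ B ⟧ | ⟦ C ⟧
... | false | false | _     = refl
... | false | true  | false = refl
... | false | true  | true  = refl
... | true  | _     | false = refl
... | true  | false | true  = refl
... | true  | true  | true  = refl
⊢⇒⟦⟧≡true (ax10 A)   = refl
⊢⇒⟦⟧≡true (ax11 A t) rewrite ⟦⟧-sub (single t) A = ∨-inverseˡ ⟦ A ⟧
⊢⇒⟦⟧≡true (ax12 A B) rewrite ⟦⟧-weaken B = ∨-inverseˡ (not ⟦ A ⟧ ∨ᵇ ⟦ B ⟧)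
⊢⇒⟦⟧≡true (ax13 A B) rewrite ⟦⟧-weaken B = ∨-inverseˡ (not ⟦ B ⟧ ∨ᵇ ⟦ A ⟧)
⊢⇒⟦⟧≡true (ax14 A t) rewrite ⟦⟧-sub (single t) A = ∨-inverseˡ ⟦ A ⟧
⊢⇒⟦⟧≡true (ax15 A) with ⟦ A ⟧
... | false = refl
... | true  = refl
⊢⇒⟦⟧≡true (ax16 A) with ⟦ A ⟧
... | false = refl
... | true  = refl
⊢⇒⟦⟧≡true (ax17 A B) with ⟦ A ⟧ | ⟦ B ⟧
... | false | _     = refl
... | true  | false = refl
... | true  | true  = refl
⊢⇒⟦⟧≡true (ax18 A B) with ⟦ A ⟧ | ⟦ B ⟧
... | false | false = refl
... | false | true  = refl
... | true  | _     = refl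
⊢⇒⟦⟧≡true (ax19 A B) with ⟦ A ⟧ | ⟦ B ⟧
... | false | _     = refl
... | true  | false = refl
... | true  | true  = refl
⊢⇒⟦⟧≡true (ax20 A) with ⟦ A ⟧
... | false = refl
... | true  = refl
⊢⇒⟦⟧≡true (ax21 A) with ⟦ A ⟧
... | false = refl
... | true  = refl
⊢⇒⟦⟧≡true (i1 A) with ⟦ A ⟧
... | false = refl
... | true  = refl
⊢⇒⟦⟧≡true (i2 A) with ⟦ A ⟧
... | false = refl
... | true  = refl
⊢⇒⟦⟧≡true (i3 A) with ⟦ A ⟧
... | false = refl
... | true  = refl
⊢⇒⟦⟧≡true (mp {A} d e) with ⟦ A ⟧ | ⊢⇒⟦⟧≡true d | ⊢⇒⟦⟧≡true e
... | true | A⇒B-true | refl = A⇒B-true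
⊢⇒⟦⟧≡true (gen d) = ⊢⇒⟦⟧≡true d

⊬⊥ : ¬ (⊢ ⊥ᶠ)
⊬⊥ d with ⊢⇒⟦⟧≡true d
... | ()

⊢-∧-intro : ∀ {A B} → ⊢ A → ⊢ B → ⊢ A ∧ B
⊢-∧-intro {A} {B} a b = mp (mp (mp (ax6 A B (⊥ᶠ ⇒ ⊥ᶠ)) (mp (ax1 _ _) a)) (mp (ax1 _ _) b)) (ax10 ⊥ᶠ)

⊢-⇔ : ∀ {A B} → ⊢ A ⇔ᶠ B → (⊢ A) ⇔ (⊢ B)
⊢-⇔ A⇔B = mk⇔ (mp (mp (ax4 _ _) A⇔B)) (mp (mp (ax5 _ _) A⇔B))

size-[con] : ∀ {k} A c → size A ≤ k → size (A [ con c ]) ≤ k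
size-[con] A c rewrite size-sub (single (con c)) A = id

Π-⇔ : ∀ {I : Set} {P Q : I → Set} → (∀ i → P i ⇔ Q i) → (∀ i → P i) ⇔ (∀ i → Q i)
Π-⇔ P⇔Q = mk⇔ (λ p i → to (P⇔Q i) (p i)) (λ q i → from (P⇔Q i) (q i))

private
  summand≤ˡ : ∀ {m n o} → m + n ≤ o → m ≤ o
  summand≤ˡ = m+n≤o⇒m≤o _

  summand≤ʳ : ∀ {m n o} → m + n ≤ o → n ≤ o
  summand≤ʳ = m+n≤o⇒n≤o _

mutual
  S⁺-fuel : ∀ {k k'} A → size A ≤ k → size A ≤ k' → S⁺ k A ⇔ S⁺ k' A
  S⁺-fuel {suc k} {suc k'} (pred p ts) _ _ = ⇔.refl
  S⁺-fuel {suc k} {suc k'} ⊥ᶠ          _ _ = ⇔.refl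
  S⁺-fuel {suc k} {suc k'} (∼ A)   (s≤s b) (s≤s b') = S⁻-fuel A b b'
  S⁺-fuel {suc k} {suc k'} (A ∧ B) (s≤s b) (s≤s b') =
    S⁺-fuel A (summand≤ˡ b) (summand≤ˡ b') ×-⇔ S⁺-fuel B (summand≤ʳ b) (summand≤ʳ b')
  S⁺-fuel {suc k} {suc k'} (A ∨ B) (s≤s b) (s≤s b') =
    S⁺-fuel A (summand≤ˡ b) (summand≤ˡ b') ⊎-⇔ S⁺-fuel B (summand≤ʳ b) (summand≤ʳ b')
  S⁺-fuel {suc k} {suc k'} (A ⇒ B) (s≤s b) (s≤s b') =
    ⇔.refl ×-⇔ →-cong-⇔ (S⁺-fuel A (summand≤ˡ b) (summand≤ˡ b'))
                        (S⁺-fuel B (summand≤ʳ b) (summand≤ʳ b'))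
  S⁺-fuel {suc k} {suc k'} (all A) (s≤s b) (s≤s b') =
    ⇔.refl ×-⇔ Π-⇔ λ c → S⁺-fuel (A [ con c ]) (size-[con] A c b) (size-[con] A c b')
  S⁺-fuel {suc k} {suc k'} (ex A)  (s≤s b) (s≤s b') =
    Σ-⇔ (↠-id Con) λ {c} → S⁺-fuel (A [ con c ]) (size-[con] A c b) (size-[con] A c b')

  S⁻-fuel : ∀ {k k'} A → size A ≤ k → size A ≤ k' → S⁻ k A ⇔ S⁻ k' A
  S⁻-fuel {suc k} {suc k'} (pred p ts) _ _ = ⇔.refl
  S⁻-fuel {suc k} {suc k'} ⊥ᶠ          _ _ = ⇔.refl
  S⁻-fuel {suc k} {suc k'} (∼ A)   (s≤s b) (s≤s b') = S⁺-fuel A b b'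
  S⁻-fuel {suc k} {suc k'} (A ∧ B) (s≤s b) (s≤s b') =
    S⁻-fuel A (summand≤ˡ b) (summand≤ˡ b') ⊎-⇔ S⁻-fuel B (summand≤ʳ b) (summand≤ʳ b')
  S⁻-fuel {suc k} {suc k'} (A ∨ B) (s≤s b) (s≤s b') =
    S⁻-fuel A (summand≤ˡ b) (summand≤ˡ b') ×-⇔ S⁻-fuel B (summand≤ʳ b) (summand≤ʳ b')
  S⁻-fuel {suc k} {suc k'} (A ⇒ B) (s≤s b) (s≤s b') =
    ⇔.refl ×-⇔ S⁻-fuel B (summand≤ʳ b) (summand≤ʳ b')
  S⁻-fuel {suc k} {suc k'} (all A) (s≤s b) (s≤s b') =
    Σ-⇔ (↠-id Con) λ {c} → S⁻-fuel (A [ con c ]) (size-[con] A c b) (size-[con] A c b')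
  S⁻-fuel {suc k} {suc k'} (ex A)  (s≤s b) (s≤s b') =
    ⇔.refl ×-⇔ Π-⇔ λ c → S⁻-fuel (A [ con c ]) (size-[con] A c b) (size-[con] A c b')

module _ (A B : Fm) where
  private
    fuel⁺ˡ : S⁺ (size A + size B) A ⇔ |⁺ A
    fuel⁺ˡ = S⁺-fuel A (m≤m+n _ _) ≤-refl
    fuel⁺ʳ : S⁺ (size A + size B) B ⇔ |⁺ B
    fuel⁺ʳ = S⁺-fuel B (m≤n+m (size B) (size A)) ≤-refl
    fuel⁻ˡ : S⁻ (size A + size B) A ⇔ |⁻ A
    fuel⁻ˡ = S⁻-fuel A (m≤m+n _ _) ≤-refl
    fuel⁻ʳ : S⁻ (size A + size B) B ⇔ |⁻ B
    fuel⁻ʳ = S⁻-fuel B (m≤n+m (size B) (size A)) ≤-refl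

  |⁺-∧ : |⁺ (A ∧ B) ⇔ (|⁺ A × |⁺ B)
  |⁺-∧ = fuel⁺ˡ ×-⇔ fuel⁺ʳ

  |⁺-∨ : |⁺ (A ∨ B) ⇔ (|⁺ A ⊎ |⁺ B)
  |⁺-∨ = fuel⁺ˡ ⊎-⇔ fuel⁺ʳ

  |⁺-⇒ : |⁺ (A ⇒ B) ⇔ ((⊢ A ⇒ B) × (|⁺ A → |⁺ B))
  |⁺-⇒ = ⇔.refl ×-⇔ →-cong-⇔ fuel⁺ˡ fuel⁺ʳ

  |⁻-∧ : |⁻ (A ∧ B) ⇔ (|⁻ A ⊎ |⁻ B)
  |⁻-∧ = fuel⁻ˡ ⊎-⇔ fuel⁻ʳ

  |⁻-∨ : |⁻ (A ∨ B) ⇔ (|⁻ A × |⁻ B)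
  |⁻-∨ = fuel⁻ˡ ×-⇔ fuel⁻ʳ

  |⁻-⇒ : |⁻ (A ⇒ B) ⇔ ((⊢ ¬ᶠ (∼ A)) × |⁻ B)
  |⁻-⇒ = ⇔.refl ×-⇔ fuel⁻ʳ

module _ (A : Fm) where
  private
    fuel⁺ : ∀ c → S⁺ (size A) (A [ con c ]) ⇔ |⁺ (A [ con c ])
    fuel⁺ c = S⁺-fuel (A [ con c ]) (size-[con] A c ≤-refl) ≤-refl
    fuel⁻ : ∀ c → S⁻ (size A) (A [ con c ]) ⇔ |⁻ (A [ con c ])
    fuel⁻ c = S⁻-fuel (A [ con c ]) (size-[con] A c ≤-refl) ≤-refl

  |⁺-all : |⁺ all A ⇔ ((⊢ all A) × (∀ c → |⁺ (A [ con c ])))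
  |⁺-all = ⇔.refl ×-⇔ Π-⇔ fuel⁺

  |⁺-ex : |⁺ ex A ⇔ Σ Con (λ c → |⁺ (A [ con c ]))
  |⁺-ex = Σ-⇔ (↠-id Con) (fuel⁺ _)

  |⁻-all : |⁻ all A ⇔ Σ Con (λ c → |⁻ (A [ con c ]))
  |⁻-all = Σ-⇔ (↠-id Con) (fuel⁻ _)

  |⁻-ex : |⁻ ex A ⇔ ((⊢ ∼ ex A) × (∀ c → |⁻ (A [ con c ])))
  |⁻-ex = ⇔.refl ×-⇔ Π-⇔ fuel⁻

mutual
  S⁺⇒⊢ : ∀ k A → S⁺ k A → ⊢ A
  S⁺⇒⊢ (suc k) (pred p ts) d        = d
  S⁺⇒⊢ (suc k) (∼ A)       s        = S⁻⇒⊢∼ k A s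
  S⁺⇒⊢ (suc k) (A ∧ B)     (s , s') = ⊢-∧-intro (S⁺⇒⊢ k A s) (S⁺⇒⊢ k B s')
  S⁺⇒⊢ (suc k) (A ∨ B)     (inj₁ s) = mp (ax7 A B) (S⁺⇒⊢ k A s)
  S⁺⇒⊢ (suc k) (A ∨ B)     (inj₂ s) = mp (ax8 A B) (S⁺⇒⊢ k B s)
  S⁺⇒⊢ (suc k) (A ⇒ B)     (d , _)  = d
  S⁺⇒⊢ (suc k) (all A)     (d , _)  = d
  S⁺⇒⊢ (suc k) (ex A)      (c , s)  = mp (ax11 A (con c)) (S⁺⇒⊢ k (A [ con c ]) s)

  S⁻⇒⊢∼ : ∀ k A → S⁻ k A → ⊢ ∼ A
  S⁻⇒⊢∼ (suc k) (pred p ts) d        = d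
  S⁻⇒⊢∼ (suc k) ⊥ᶠ          _        = mp (ax15 (⊥ᶠ ⇒ ⊥ᶠ)) (ax10 ⊥ᶠ)
  S⁻⇒⊢∼ (suc k) (∼ A)       s        = from (⊢-⇔ (ax16 A)) (S⁺⇒⊢ k A s)
  S⁻⇒⊢∼ (suc k) (A ∧ B)     (inj₁ s) = from (⊢-⇔ (ax17 A B)) (mp (ax7 _ _) (S⁻⇒⊢∼ k A s))
  S⁻⇒⊢∼ (suc k) (A ∧ B)     (inj₂ s) = from (⊢-⇔ (ax17 A B)) (mp (ax8 _ _) (S⁻⇒⊢∼ k B s))
  S⁻⇒⊢∼ (suc k) (A ∨ B)     (s , s') = from (⊢-⇔ (ax18 A B)) (⊢-∧-intro (S⁻⇒⊢∼ k A s) (S⁻⇒⊢∼ k B s'))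
  S⁻⇒⊢∼ (suc k) (A ⇒ B)     (d , s)  = from (⊢-⇔ (ax19 A B)) (⊢-∧-intro d (S⁻⇒⊢∼ k B s))
  S⁻⇒⊢∼ (suc k) (all A)     (c , s)  =
    from (⊢-⇔ (ax20 A)) (mp (ax11 (∼ A) (con c)) (S⁻⇒⊢∼ k (A [ con c ]) s))
  S⁻⇒⊢∼ (suc k) (ex A)      (d , _)  = d

|⁺⇒⊢ : ∀ A → |⁺ A → ⊢ A
|⁺⇒⊢ A = S⁺⇒⊢ (size A) A

|⁻⇒⊢∼ : ∀ A → |⁻ A → ⊢ ∼ A
|⁻⇒⊢∼ A = S⁻⇒⊢∼ (size A) A

⇒-intro : ∀ {A B} → ⊢ A ⇒ B → (|⁺ A → |⁺ B) → |⁺ (A ⇒ B)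
⇒-intro {A} {B} d f = from (|⁺-⇒ A B) (d , f)

⇒-elim : ∀ {A B} → |⁺ (A ⇒ B) → |⁺ A → |⁺ B
⇒-elim {A} {B} s = proj₂ (to (|⁺-⇒ A B) s)

⇒-intro₂ : ∀ {A B C} → ⊢ A ⇒ (B ⇒ C) → (|⁺ A → |⁺ B → |⁺ C) → |⁺ (A ⇒ (B ⇒ C))
⇒-intro₂ {A} d f = ⇒-intro d λ a → ⇒-intro (mp d (|⁺⇒⊢ A a)) (f a)

⇒-intro₃ : ∀ {A B C D} → ⊢ A ⇒ (B ⇒ (C ⇒ D)) →
           (|⁺ A → |⁺ B → |⁺ C → |⁺ D) → |⁺ (A ⇒ (B ⇒ (C ⇒ D)))
⇒-intro₃ {A} d f = ⇒-intro d λ a → ⇒-intro₂ (mp d (|⁺⇒⊢ A a)) (f a)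

⇔-intro : ∀ {A B} → ⊢ A ⇔ᶠ B → |⁺ A ⇔ |⁺ B → |⁺ (A ⇔ᶠ B)
⇔-intro {A} {B} d s = from (|⁺-∧ (A ⇒ B) (B ⇒ A))
  (⇒-intro (mp (ax4 _ _) d) (to s) , ⇒-intro (mp (ax5 _ _) d) (from s))

|⁺-¬ : ∀ A → |⁺ (¬ᶠ A) ⇔ (⊢ ¬ᶠ A)
|⁺-¬ A = mk⇔ (|⁺⇒⊢ (¬ᶠ A)) λ d → ⇒-intro d λ a → ⊬⊥ (mp d (|⁺⇒⊢ A a))

∀-elim : ∀ {A} → |⁺ all A → ∀ c → |⁺ (A [ con c ])
∀-elim {A} s = proj₂ (to (|⁺-all A) s)

slashed-ax1 : ∀ A B → |⁺ (A ⇒ (B ⇒ A))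
slashed-ax1 A B = ⇒-intro₂ (ax1 A B) λ a _ → a

slashed-ax2 : ∀ A B C → |⁺ ((A ⇒ (B ⇒ C)) ⇒ ((A ⇒ B) ⇒ (A ⇒ C)))
slashed-ax2 A B C = ⇒-intro₃ (ax2 A B C) λ f g a → ⇒-elim (⇒-elim f a) (⇒-elim g a)

slashed-ax4 : ∀ A B → |⁺ ((A ∧ B) ⇒ A)
slashed-ax4 A B = ⇒-intro (ax4 A B) (proj₁ ∘ to (|⁺-∧ A B))

slashed-ax5 : ∀ A B → |⁺ ((A ∧ B) ⇒ B)
slashed-ax5 A B = ⇒-intro (ax5 A B) (proj₂ ∘ to (|⁺-∧ A B))

slashed-ax6 : ∀ A B C → |⁺ ((C ⇒ A) ⇒ ((C ⇒ B) ⇒ (C ⇒ (A ∧ B))))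
slashed-ax6 A B C = ⇒-intro₃ (ax6 A B C) λ f g c → from (|⁺-∧ A B) (⇒-elim f c , ⇒-elim g c)

slashed-ax7 : ∀ A B → |⁺ (A ⇒ (A ∨ B))
slashed-ax7 A B = ⇒-intro (ax7 A B) (from (|⁺-∨ A B) ∘ inj₁)

slashed-ax8 : ∀ A B → |⁺ (B ⇒ (A ∨ B))
slashed-ax8 A B = ⇒-intro (ax8 A B) (from (|⁺-∨ A B) ∘ inj₂)

slashed-ax9 : ∀ A B C → |⁺ ((A ⇒ C) ⇒ ((B ⇒ C) ⇒ ((A ∨ B) ⇒ C)))
slashed-ax9 A B C = ⇒-intro₃ (ax9 A B C) λ f g a∨b → [ ⇒-elim f , ⇒-elim g ] (to (|⁺-∨ A B) a∨b)

slashed-ax10 : ∀ A → |⁺ (⊥ᶠ ⇒ A)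
slashed-ax10 A = ⇒-intro (ax10 A) λ ()

slashed-ax11 : ∀ A c → |⁺ (A [ con c ] ⇒ ex A)
slashed-ax11 A c = ⇒-intro (ax11 A (con c)) λ a → from (|⁺-ex A) (c , a)

slashed-ax12 : ∀ A B → |⁺ (all (A ⇒ weaken B) ⇒ (ex A ⇒ B))
slashed-ax12 A B = ⇒-intro₂ (ax12 A B) λ f e →
  let c , a = to (|⁺-ex A) e
  in subst |⁺_ (weaken-[] (con c) B) (⇒-elim (∀-elim f c) a)

slashed-ax13 : ∀ A B → |⁺ (all (weaken B ⇒ A) ⇒ (B ⇒ all A))
slashed-ax13 A B = ⇒-intro₂ (ax13 A B) λ f b →
  from (|⁺-all A) (mp (mp (ax13 A B) (|⁺⇒⊢ _ f)) (|⁺⇒⊢ B b) , λ c →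
    ⇒-elim (subst (λ X → |⁺ (X ⇒ A [ con c ])) (weaken-[] (con c) B) (∀-elim f c)) b)

slashed-ax14 : ∀ A c → |⁺ (all A ⇒ A [ con c ])
slashed-ax14 A c = ⇒-intro (ax14 A (con c)) λ f → ∀-elim f c

slashed-ax15 : ∀ A → |⁺ (A ⇒ ∼ ⊥ᶠ)
slashed-ax15 A = ⇒-intro (ax15 A) λ _ → tt

slashed-ax16 : ∀ A → |⁺ ((∼ ∼ A) ⇔ᶠ A)
slashed-ax16 A = ⇔-intro (ax16 A) ⇔.refl

slashed-ax17 : ∀ A B → |⁺ ((∼ (A ∧ B)) ⇔ᶠ (∼ A ∨ ∼ B))
slashed-ax17 A B = ⇔-intro (ax17 A B) (⇔.trans (|⁻-∧ A B) (⇔.sym (|⁺-∨ (∼ A) (∼ B))))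

slashed-ax18 : ∀ A B → |⁺ ((∼ (A ∨ B)) ⇔ᶠ (∼ A ∧ ∼ B))
slashed-ax18 A B = ⇔-intro (ax18 A B) (⇔.trans (|⁻-∨ A B) (⇔.sym (|⁺-∧ (∼ A) (∼ B))))

slashed-ax19 : ∀ A B → |⁺ ((∼ (A ⇒ B)) ⇔ᶠ ((¬ᶠ (∼ A)) ∧ ∼ B))
slashed-ax19 A B = ⇔-intro (ax19 A B)
  (⇔.trans (|⁻-⇒ A B)
  (⇔.trans (⇔.sym (|⁺-¬ (∼ A)) ×-⇔ ⇔.refl)
           (⇔.sym (|⁺-∧ (¬ᶠ (∼ A)) (∼ B)))))

slashed-ax20 : ∀ A → |⁺ ((∼ all A) ⇔ᶠ ex (∼ A))
slashed-ax20 A = ⇔-intro (ax20 A) (⇔.trans (|⁻-all A) (⇔.sym (|⁺-ex (∼ A))))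

slashed-ax21 : ∀ A → |⁺ ((∼ ex A) ⇔ᶠ all (∼ A))
slashed-ax21 A = ⇔-intro (ax21 A)
  (⇔.trans (|⁻-ex A)
  (⇔.trans (⊢-⇔ (ax21 A) ×-⇔ ⇔.refl)
           (⇔.sym (|⁺-all (∼ A)))))

slashed-i1 : ∀ A → |⁺ (all (¬ᶠ ¬ᶠ A) ⇒ (¬ᶠ ¬ᶠ all A))
slashed-i1 A = ⇒-intro (i1 A) λ f → from (|⁺-¬ (¬ᶠ all A)) (mp (i1 A) (|⁺⇒⊢ _ f))

slashed-i2 : ∀ A → |⁺ ((∼ A) ⇒ (¬ᶠ A))
slashed-i2 A = ⇒-intro (i2 A) λ n → from (|⁺-¬ A) (mp (i2 A) (|⁻⇒⊢∼ A n))

slashed-i3 : ∀ A → |⁺ (¬ᶠ ¬ᶠ (A ∨ ∼ A))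
slashed-i3 A = from (|⁺-¬ (¬ᶠ (A ∨ ∼ A))) (i3 A)

inst : (ℕ → Con) → ℕ → Term
inst σ = con ∘ σ

groundT : (ℕ → Con) → Term → Con
groundT σ (var k) = σ k
groundT σ (con c) = c

subT-inst : ∀ σ t → subT (inst σ) t ≡ con (groundT σ t)
subT-inst σ (var k) = refl
subT-inst σ (con c) = refl

inst-∷ₛ : ∀ σ c → con c ∷ₛ inst σ ≗ inst (c ∷ₛ σ)
inst-∷ₛ σ c zero    = refl
inst-∷ₛ σ c (suc k) = refl

sub-exts-inst-[] : ∀ σ c A → sub (exts (inst σ)) A [ con c ] ≡ sub (inst (c ∷ₛ σ)) A
sub-exts-inst-[] σ c A = trans (sub-exts-[] (inst σ) (con c) A) (sub-cong (inst-∷ₛ σ c) A)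

⊢⇒|⁺-inst : ∀ {A} → ⊢ A → ∀ σ → |⁺ sub (inst σ) A
⊢⇒|⁺-inst (ax1 A B)   σ = slashed-ax1 _ _
⊢⇒|⁺-inst (ax2 A B C) σ = slashed-ax2 _ _ _
⊢⇒|⁺-inst (ax4 A B)   σ = slashed-ax4 _ _
⊢⇒|⁺-inst (ax5 A B)   σ = slashed-ax5 _ _
⊢⇒|⁺-inst (ax6 A B C) σ = slashed-ax6 _ _ _
⊢⇒|⁺-inst (ax7 A B)   σ = slashed-ax7 _ _
⊢⇒|⁺-inst (ax8 A B)   σ = slashed-ax8 _ _
⊢⇒|⁺-inst (ax9 A B C) σ = slashed-ax9 _ _ _
⊢⇒|⁺-inst (ax10 A)    σ = slashed-ax10 _
⊢⇒|⁺-inst (ax11 A t)  σ rewrite sub-[] (inst σ) t A | subT-inst σ t = slashed-ax11 _ _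
⊢⇒|⁺-inst (ax12 A B)  σ rewrite sub-weaken (inst σ) B = slashed-ax12 _ _
⊢⇒|⁺-inst (ax13 A B)  σ rewrite sub-weaken (inst σ) B = slashed-ax13 _ _
⊢⇒|⁺-inst (ax14 A t)  σ rewrite sub-[] (inst σ) t A | subT-inst σ t = slashed-ax14 _ _
⊢⇒|⁺-inst (ax15 A)    σ = slashed-ax15 _
⊢⇒|⁺-inst (ax16 A)    σ = slashed-ax16 _
⊢⇒|⁺-inst (ax17 A B)  σ = slashed-ax17 _ _
⊢⇒|⁺-inst (ax18 A B)  σ = slashed-ax18 _ _
⊢⇒|⁺-inst (ax19 A B)  σ = slashed-ax19 _ _
⊢⇒|⁺-inst (ax20 A)    σ = slashed-ax20 _
⊢⇒|⁺-inst (ax21 A)    σ = slashed-ax21 _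
⊢⇒|⁺-inst (i1 A)      σ = slashed-i1 _
⊢⇒|⁺-inst (i2 A)      σ = slashed-i2 _
⊢⇒|⁺-inst (i3 A)      σ = slashed-i3 _
⊢⇒|⁺-inst (mp d e)    σ = ⇒-elim (⊢⇒|⁺-inst d σ) (⊢⇒|⁺-inst e σ)
⊢⇒|⁺-inst (gen {A} d) σ = from (|⁺-all (sub (exts (inst σ)) A))
  (⊢-sub (gen d) (inst σ) ,
   λ c → subst |⁺_ (sym (sub-exts-inst-[] σ c A)) (⊢⇒|⁺-inst d (c ∷ₛ σ)))

lemma3p10 : (A : Fm) → Sentence A → ⊢ A → |⁺ A
lemma3p10 A sentence d = subst |⁺_ (sub-sentence (inst σ) A sentence) (⊢⇒|⁺-inst d σ)
  where
  σ : ℕ → Con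
  σ _ = 0
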